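{- Let $X$ be a set, $F:\mathcal{P}(X)\to\mathcal{P}(X)$ an interior operator, and $\kappa$ a cardinal. If the sup-lattice $(\mathrm{Fix}(F),\subseteq,\bigcup)$ has no basis of cardinality $\kappa$, then there is no resolution of $F$ whose interpolant has cardinality less than $\kappa$; that is, there is no set $Y$ with $|Y|<\kappa$ and relation $r\subseteq X\times Y$ such that $F=\langle r\rangle\circ[r^{\sim}]$.
   Context: An interior operator on $\mathcal{P}(X)$ is a map that is monotonic for inclusion, contractive ($F(U)\subseteq U$) and satisfies $F(U)\subseteq F(F(U))$. $\mathrm{Fix}(F)=\{U\subseteq X\mid F(U)=U\}$. A basis of $(\mathrm{Fix}(F),\subseteq,\bigcup)$ is a family $(U_i)_{i\in I}$ of elements of $\mathrm{Fix}(F)$ such that every $V\in\mathrm{Fix}(F)$ satisfies $V=\bigcup\{U_i\mid U_i\subseteq V\}$; its cardinality is that of $I$. For $r\subseteq X\times Y$, $r^{\sim}=\{(y,x)\mid (x,y)\in r\}$; for $t\subseteq A\times B$ and $V\subseteq B$, $\langle t\rangle(V)=\{a\in A\mid \exists b,\ (a,b)\in t\text{ and } b\in V\}$ and $[t](V)=\{a\in A\mid\forall b,\ (a,b)\in t\Rightarrow b\in V\}$. -}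

module Defs where

open import Level using (Level; suc)
open import Data.Product using (Σ; ∃; _×_; _,_)
open import Relation.Unary using (Pred; _⊆_; _≐_; _∈_)
open import Relation.Binary.Core using (REL)
open import Relation.Nullary using (¬_)
open import Function.Bundles using (_↔_; _↣_)

private variable ℓ : Level

record IsInterior {X : Set ℓ} (F : Pred X ℓ → Pred X ℓ) : Set (suc ℓ) where
  field
    mono        : ∀ {U V : Pred X ℓ} → U ⊆ V → F U ⊆ F V
    contractive : ∀ (U : Pred X ℓ) → F U ⊆ U
    idem        : ∀ (U : Pred X ℓ) → F U ⊆ F (F U)

Fix : {X : Set ℓ} → (Pred X ℓ → Pred X ℓ) → Pred (Pred X ℓ) ℓ
Fix F U = F U ≐ U

_˘ : {X Y : Set ℓ} → REL X Y ℓ → REL Y X ℓ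
(r ˘) y x = r x y

⟨_⟩ : {A B : Set ℓ} → REL A B ℓ → Pred B ℓ → Pred A ℓ
⟨ t ⟩ V a = ∃ λ b → t a b × b ∈ V

[_] : {A B : Set ℓ} → REL A B ℓ → Pred B ℓ → Pred A ℓ
[ t ] V a = ∀ b → t a b → b ∈ V

record IsBasis {X I : Set ℓ} (F : Pred X ℓ → Pred X ℓ) (U : I → Pred X ℓ) : Set (suc ℓ) where
  field
    fixed : ∀ i → U i ∈ Fix F
    generates : ∀ (V : Pred X ℓ) → V ∈ Fix F →
                V ≐ (λ x → ∃ λ i → (U i ⊆ V) × x ∈ U i)

-- Fix F has a basis of cardinality κ, where κ is represented by a type K:
-- a basis indexed by a set I in bijection with K.
HasBasisOfCard : {X : Set ℓ} → (Pred X ℓ → Pred X ℓ) → Set ℓ → Set (suc ℓ)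
HasBasisOfCard {ℓ} {X} F K =
  Σ (Set ℓ) λ I → (I ↔ K) × Σ (I → Pred X ℓ) λ U → IsBasis F U

_≺_ : Set ℓ → Set ℓ → Set ℓ
Y ≺ K = (Y ↣ K) × ¬ (Y ↔ K)

IsResolution : ∀ {ℓ} {X Y : Set ℓ} → (Pred X ℓ → Pred X ℓ) → REL X Y ℓ → Set (suc ℓ)
IsResolution {ℓ} {X} F r = ∀ (U : Pred X ℓ) → F U ≐ ⟨ r ⟩ ([ r ˘ ] U)

-- If F = ⟨ r ⟩ ∘ [ r˘ ] with r ⊆ X × Y, every fixed point V of F is the union
-- of the fixed points ⟨ r ⟩ ｛ y ｝ for the y ∈ [ r˘ ] V, so these |Y| sets form
-- a basis of Fix F. Pushing this basis forward along an injection Y ↣ K (a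
-- fibre contains at most one basis element) yields a basis indexed by K.
module Submission where

open import Defs
open import Level using (Level)
open import Data.Product using (Σ; _×_; _,_; proj₁; proj₂)
open import Relation.Unary using (Pred; _⊆_; _∈_; ⋃; ｛_｝)
open import Relation.Binary.Core using (REL)
open import Relation.Nullary using (¬_)
open import Relation.Binary.PropositionalEquality using (_≡_; refl; subst)
open import Function.Bundles using (Injection; _↣_)
open import Function.Properties.Inverse using (↔-refl)

private variable
  ℓ : Level
  X Y K : Set ℓ

⋃-fixed : {F : Pred X ℓ → Pred X ℓ} → IsInterior F →
          {I : Set ℓ} (U : I → Pred X ℓ) → (∀ i → U i ∈ Fix F) → ⋃ I U ∈ Fix F
⋃-fixed int {I} U fixed =
    IsInterior.contractive int (⋃ I U)
  , λ { (i , x∈Ui) → IsInterior.mono int (λ x∈Ui′ → i , x∈Ui′) (proj₂ (fixed i) x∈Ui) }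

⊆-[˘]⟨⟩ : (r : REL X Y ℓ) (W : Pred Y ℓ) → W ⊆ [ r ˘ ] (⟨ r ⟩ W)
⊆-[˘]⟨⟩ r W {y} y∈W x rxy = y , rxy , y∈W

module _ {F : Pred X ℓ → Pred X ℓ} (int : IsInterior F)
         {r : REL X Y ℓ} (res : IsResolution F r) where

  ⟨⟩-fixed : (W : Pred Y ℓ) → ⟨ r ⟩ W ∈ Fix F
  ⟨⟩-fixed W =
      IsInterior.contractive int (⟨ r ⟩ W)
    , λ { (y , rxy , y∈W) → proj₂ (res (⟨ r ⟩ W)) (y , rxy , ⊆-[˘]⟨⟩ r W y∈W) }

  ⟨⟩-singletons-basis : IsBasis F (λ y → ⟨ r ⟩ ｛ y ｝)
  ⟨⟩-singletons-basis = record
    { fixed     = λ y → ⟨⟩-fixed ｛ y ｝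
    ; generates = λ V fixV →
          (λ x∈V → let (y , rxy , y∈[r˘]V) = proj₁ (res V) (proj₂ fixV x∈V)
                   in  y , (λ { (_ , rzy , refl) → y∈[r˘]V _ rzy }) , (y , rxy , refl))
        , λ { (_ , Uy⊆V , x∈Uy) → Uy⊆V x∈Uy }
    }

basis-along-injection : {F : Pred X ℓ → Pred X ℓ} → IsInterior F →
                        {U : Y → Pred X ℓ} → IsBasis F U → (f : Y ↣ K) →
                        IsBasis F (λ k → ⋃ (Σ Y λ y → Injection.to f y ≡ k) (λ (y , _) → U y))
basis-along-injection int {U} basis f = record
  { fixed     = λ k → ⋃-fixed int _ (λ (y , _) → IsBasis.fixed basis y)
  ; generates = λ V fixV →
        (λ x∈V → let (y , Uy⊆V , x∈Uy) = proj₁ (IsBasis.generates basis V fixV) x∈V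
                 in  to y , (λ { ((y′ , fy′≡fy) , z∈Uy′) →
                                   Uy⊆V (subst (λ w → _ ∈ U w) (injective fy′≡fy) z∈Uy′) })
                          , ((y , refl) , x∈Uy))
      , λ { (_ , Uk⊆V , x∈Uk) → Uk⊆V x∈Uk }
  }
  where open Injection f using (to; injective)

lemma6 : ∀ {ℓ : Level} (X : Set ℓ) (F : Pred X ℓ → Pred X ℓ) → IsInterior F →
    (K : Set ℓ) → ¬ HasBasisOfCard F K →
    ¬ (Σ (Set ℓ) λ Y → (Y ≺ K) × Σ (REL X Y ℓ) λ r → IsResolution F r)
lemma6 X F int K noBasis (Y , (Y↣K , _) , r , res) =
  noBasis (K , ↔-refl , _ , basis-along-injection int (⟨⟩-singletons-basis int res) Y↣K)
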